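{- Let $(\mathcal C,\otimes,I,\gamma)$ be a symmetric monoidal category and $\mathcal T$ a centralisable strong monad on it, and let $\mathcal Z$ be the commutative submonad of $\mathcal T$ with submonad monomorphism $\iota:\mathcal Z\Rightarrow\mathcal T$ obtained from the terminal central cones $(\mathcal ZX,\iota_X)$ of $\mathcal T$. Then the canonical embedding functor $\mathcal I:\mathcal C_{\mathcal Z}\to\mathcal C_{\mathcal T}$ corestricts to an isomorphism of categories $\mathcal C_{\mathcal Z}\cong Z(\mathcal C_{\mathcal T})$.
   Context: $\mathcal T=(\mathcal T,\eta,\mu,\tau)$ with left strength $\tau$ and right strength $\tau'_{X,Y}=\mathcal T(\gamma_{Y,X})\circ\tau_{Y,X}\circ\gamma_{\mathcal TX,Y}$. A central cone of $\mathcal T$ at $X$ is $(W,\iota)$, $\iota:W\to\mathcal TX$, with $\mu\circ\mathcal T\tau'_{X,Y}\circ\tau_{\mathcal TX,Y}\circ(\iota\otimes\mathcal TY)=\mu\circ\mathcal T\tau_{X,Y}\circ\tau'_{X,\mathcal TY}\circ(\iota\otimes\mathcal TY)$ for all $Y$; a terminal central cone is terminal among these (morphisms $\varphi$ with $\iota\circ\varphi=\iota'$); $\mathcal T$ is centralisable if every object has a terminal central cone $(\mathcal ZX,\iota_X)$. In that case $X\mapsto\mathcal ZX$ extends uniquely to a commutative strong monad $\mathcal Z$ such that $\iota$ is a monomorphism of strong monads (the centre of $\mathcal T$). Kleisli categories: $\mathcal C_{\mathcal T}$ has morphisms $X\to\mathcal TY$, composition $g\odot f=\mu\circ\mathcal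 Tg\circ f$. The canonical embedding $\mathcal I$ is the identity on objects and sends $f:X\to\mathcal ZY$ to $\iota_Y\circ f$. For $f:Y\to\mathcal TZ$, $f\otimes_l X=\tau'_{Z,X}\circ(f\otimes X)$ and $X\otimes_r f=\tau_{X,Z}\circ(X\otimes f)$; $f:X\to\mathcal TY$ is central if $(f\otimes_l Y')\odot(X\otimes_r f')=(Y\otimes_r f')\odot(f\otimes_l X')$ for every $f':X'\to\mathcal TY'$. $Z(\mathcal C_{\mathcal T})$ is the subcategory of $\mathcal C_{\mathcal T}$ with all objects and central morphisms. -}

module Defs where

open import Level using (Level; _⊔_) renaming (suc to lsuc)
open import Relation.Binary using (Rel; IsEquivalence)

record Category (o ℓ e : Level) : Set (lsuc (o ⊔ ℓ ⊔ e)) where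
  infix  4 _≈_
  infixr 9 _∘_
  field
    Obj   : Set o
    _⇒_   : Obj → Obj → Set ℓ
    _≈_   : ∀ {A B} → Rel (A ⇒ B) e
    id    : ∀ {A} → A ⇒ A
    _∘_   : ∀ {A B C} → B ⇒ C → A ⇒ B → A ⇒ C
    equiv : ∀ {A B} → IsEquivalence (_≈_ {A} {B})
    assoc : ∀ {A B C D} {f : A ⇒ B} {g : B ⇒ C} {h : C ⇒ D} →
            (h ∘ g) ∘ f ≈ h ∘ (g ∘ f)
    identityˡ : ∀ {A B} {f : A ⇒ B} → id ∘ f ≈ f
    identityʳ : ∀ {A B} {f : A ⇒ B} → f ∘ id ≈ f
    ∘-resp-≈  : ∀ {A B C} {f h : B ⇒ C} {g i : A ⇒ B} →
                f ≈ h → g ≈ i → f ∘ g ≈ h ∘ i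

record SymmetricMonoidal {o ℓ e} (𝒞 : Category o ℓ e) : Set (o ⊔ ℓ ⊔ e) where
  open Category 𝒞
  infixr 10 _⊗₀_ _⊗₁_
  field
    _⊗₀_ : Obj → Obj → Obj
    _⊗₁_ : ∀ {A B C D} → A ⇒ B → C ⇒ D → (A ⊗₀ C) ⇒ (B ⊗₀ D)
    ⊗-id : ∀ {A B} → (id {A} ⊗₁ id {B}) ≈ id
    ⊗-∘  : ∀ {A B C D E F} {f : B ⇒ C} {g : A ⇒ B} {h : E ⇒ F} {k : D ⇒ E} →
           ((f ∘ g) ⊗₁ (h ∘ k)) ≈ (f ⊗₁ h) ∘ (g ⊗₁ k)
    ⊗-resp-≈ : ∀ {A B C D} {f f' : A ⇒ B} {g g' : C ⇒ D} →
               f ≈ f' → g ≈ g' → (f ⊗₁ g) ≈ (f' ⊗₁ g')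
    unit : Obj
    λ⇒ : ∀ {X} → (unit ⊗₀ X) ⇒ X
    λ⇐ : ∀ {X} → X ⇒ (unit ⊗₀ X)
    λ-isoˡ : ∀ {X} → λ⇐ {X} ∘ λ⇒ ≈ id
    λ-isoʳ : ∀ {X} → λ⇒ {X} ∘ λ⇐ ≈ id
    λ-natural : ∀ {X Y} {f : X ⇒ Y} → λ⇒ ∘ (id {unit} ⊗₁ f) ≈ f ∘ λ⇒
    ρ⇒ : ∀ {X} → (X ⊗₀ unit) ⇒ X
    ρ⇐ : ∀ {X} → X ⇒ (X ⊗₀ unit)
    ρ-isoˡ : ∀ {X} → ρ⇐ {X} ∘ ρ⇒ ≈ id
    ρ-isoʳ : ∀ {X} → ρ⇒ {X} ∘ ρ⇐ ≈ id
    ρ-natural : ∀ {X Y} {f : X ⇒ Y} → ρ⇒ ∘ (f ⊗₁ id {unit}) ≈ f ∘ ρ⇒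
    α⇒ : ∀ {X Y Z} → ((X ⊗₀ Y) ⊗₀ Z) ⇒ (X ⊗₀ (Y ⊗₀ Z))
    α⇐ : ∀ {X Y Z} → (X ⊗₀ (Y ⊗₀ Z)) ⇒ ((X ⊗₀ Y) ⊗₀ Z)
    α-isoˡ : ∀ {X Y Z} → α⇐ {X} {Y} {Z} ∘ α⇒ ≈ id
    α-isoʳ : ∀ {X Y Z} → α⇒ {X} {Y} {Z} ∘ α⇐ ≈ id
    α-natural : ∀ {X X' Y Y' Z Z'} {f : X ⇒ X'} {g : Y ⇒ Y'} {h : Z ⇒ Z'} →
                α⇒ ∘ ((f ⊗₁ g) ⊗₁ h) ≈ (f ⊗₁ (g ⊗₁ h)) ∘ α⇒
    triangle : ∀ {X Y} →
               (id {X} ⊗₁ λ⇒ {Y}) ∘ α⇒ {X} {unit} {Y} ≈ (ρ⇒ {X} ⊗₁ id {Y})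
    pentagon : ∀ {W X Y Z} →
               (id {W} ⊗₁ α⇒ {X} {Y} {Z}) ∘ (α⇒ {W} {X ⊗₀ Y} {Z} ∘ (α⇒ {W} {X} {Y} ⊗₁ id {Z}))
               ≈ α⇒ {W} {X} {Y ⊗₀ Z} ∘ α⇒ {W ⊗₀ X} {Y} {Z}
    γ : ∀ {X Y} → (X ⊗₀ Y) ⇒ (Y ⊗₀ X)
    γ-natural : ∀ {X X' Y Y'} {f : X ⇒ X'} {g : Y ⇒ Y'} →
                γ ∘ (f ⊗₁ g) ≈ (g ⊗₁ f) ∘ γ
    γ-involutive : ∀ {X Y} → γ {Y} {X} ∘ γ {X} {Y} ≈ id
    hexagon : ∀ {X Y Z} →
              α⇒ {Y} {Z} {X} ∘ (γ {X} {Y ⊗₀ Z} ∘ α⇒ {X} {Y} {Z})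
              ≈ (id {Y} ⊗₁ γ {X} {Z}) ∘ (α⇒ {Y} {X} {Z} ∘ (γ {X} {Y} ⊗₁ id {Z}))

record StrongMonad {o ℓ e} {𝒞 : Category o ℓ e} (M : SymmetricMonoidal 𝒞)
       : Set (o ⊔ ℓ ⊔ e) where
  open Category 𝒞
  open SymmetricMonoidal M
  field
    T₀ : Obj → Obj
    T₁ : ∀ {A B} → A ⇒ B → T₀ A ⇒ T₀ B
    T-id : ∀ {A} → T₁ (id {A}) ≈ id
    T-∘  : ∀ {A B C} {f : B ⇒ C} {g : A ⇒ B} → T₁ (f ∘ g) ≈ T₁ f ∘ T₁ g
    T-resp-≈ : ∀ {A B} {f g : A ⇒ B} → f ≈ g → T₁ f ≈ T₁ g
    η : ∀ {X} → X ⇒ T₀ X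
    μ : ∀ {X} → T₀ (T₀ X) ⇒ T₀ X
    η-natural : ∀ {X Y} {f : X ⇒ Y} → η ∘ f ≈ T₁ f ∘ η
    μ-natural : ∀ {X Y} {f : X ⇒ Y} → μ ∘ T₁ (T₁ f) ≈ T₁ f ∘ μ
    μ-assoc : ∀ {X} → μ {X} ∘ T₁ (μ {X}) ≈ μ {X} ∘ μ {T₀ X}
    μ-identityˡ : ∀ {X} → μ {X} ∘ T₁ (η {X}) ≈ id
    μ-identityʳ : ∀ {X} → μ {X} ∘ η {T₀ X} ≈ id
    τ : ∀ {X Y} → (X ⊗₀ T₀ Y) ⇒ T₀ (X ⊗₀ Y)
    τ-natural : ∀ {X X' Y Y'} {f : X ⇒ X'} {g : Y ⇒ Y'} →
                τ ∘ (f ⊗₁ T₁ g) ≈ T₁ (f ⊗₁ g) ∘ τ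
    τ-λ : ∀ {X} → T₁ (λ⇒ {X}) ∘ τ {unit} {X} ≈ λ⇒ {T₀ X}
    τ-α : ∀ {X Y Z} →
          τ {X} {Y ⊗₀ Z} ∘ ((id {X} ⊗₁ τ {Y} {Z}) ∘ α⇒ {X} {Y} {T₀ Z})
          ≈ T₁ (α⇒ {X} {Y} {Z}) ∘ τ {X ⊗₀ Y} {Z}
    τ-η : ∀ {X Y} → τ {X} {Y} ∘ (id {X} ⊗₁ η {Y}) ≈ η {X ⊗₀ Y}
    τ-μ : ∀ {X Y} → τ {X} {Y} ∘ (id {X} ⊗₁ μ {Y})
                    ≈ μ {X ⊗₀ Y} ∘ (T₁ (τ {X} {Y}) ∘ τ {X} {T₀ Y})

  τ' : ∀ {X Y} → (T₀ X ⊗₀ Y) ⇒ T₀ (X ⊗₀ Y)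
  τ' {X} {Y} = T₁ (γ {Y} {X}) ∘ (τ {Y} {X} ∘ γ {T₀ X} {Y})

  dstr₁ : ∀ X Y → (T₀ X ⊗₀ T₀ Y) ⇒ T₀ (X ⊗₀ Y)
  dstr₁ X Y = μ {X ⊗₀ Y} ∘ (T₁ (τ' {X} {Y}) ∘ τ {T₀ X} {Y})

  dstr₂ : ∀ X Y → (T₀ X ⊗₀ T₀ Y) ⇒ T₀ (X ⊗₀ Y)
  dstr₂ X Y = μ {X ⊗₀ Y} ∘ (T₁ (τ {X} {Y}) ∘ τ' {X} {T₀ Y})

  IsCommutative : Set (o ⊔ e)
  IsCommutative = ∀ X Y → dstr₁ X Y ≈ dstr₂ X Y

  IsCentralCone : (X W : Obj) → W ⇒ T₀ X → Set (o ⊔ e)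
  IsCentralCone X W ι = ∀ Y → dstr₁ X Y ∘ (ι ⊗₁ id {T₀ Y}) ≈ dstr₂ X Y ∘ (ι ⊗₁ id {T₀ Y})

  record IsTerminalCentralCone (X W : Obj) (ι : W ⇒ T₀ X) : Set (o ⊔ ℓ ⊔ e) where
    field
      central : IsCentralCone X W ι
      factor : ∀ {W'} (ι' : W' ⇒ T₀ X) → IsCentralCone X W' ι' → W' ⇒ W
      factor-commutes : ∀ {W'} (ι' : W' ⇒ T₀ X) (c : IsCentralCone X W' ι') →
                        ι ∘ factor ι' c ≈ ι'
      factor-unique : ∀ {W'} (ι' : W' ⇒ T₀ X) (c : IsCentralCone X W' ι') (φ : W' ⇒ W) →
                      ι ∘ φ ≈ ι' → φ ≈ factor ι' c

  -- Kleisli category C_T: identities η, composition g ⊙ f = μ ∘ T g ∘ f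
  infixr 9 _⊙_
  _⊙_ : ∀ {X Y Z} → Y ⇒ T₀ Z → X ⇒ T₀ Y → X ⇒ T₀ Z
  g ⊙ f = μ ∘ (T₁ g ∘ f)

  _⊗ₗ_ : ∀ {Y Z} → Y ⇒ T₀ Z → (X : Obj) → (Y ⊗₀ X) ⇒ T₀ (Z ⊗₀ X)
  f ⊗ₗ X = τ' ∘ (f ⊗₁ id {X})

  _⊗ᵣ_ : ∀ {Y Z} → (X : Obj) → Y ⇒ T₀ Z → (X ⊗₀ Y) ⇒ T₀ (X ⊗₀ Z)
  X ⊗ᵣ f = τ ∘ (id {X} ⊗₁ f)

  -- central Kleisli morphisms (the morphisms of Z(C_T))
  IsCentral : ∀ {X Y} → X ⇒ T₀ Y → Set (o ⊔ ℓ ⊔ e)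
  IsCentral {X} {Y} f = ∀ {X' Y'} (f' : X' ⇒ T₀ Y') →
    (f ⊗ₗ Y') ⊙ (X ⊗ᵣ f') ≈ (Y ⊗ᵣ f') ⊙ (f ⊗ₗ X')

record IsStrongMonadMono {o ℓ e} {𝒞 : Category o ℓ e} {M : SymmetricMonoidal 𝒞}
       (S T : StrongMonad M) (ι : ∀ {X} → Category._⇒_ 𝒞 (StrongMonad.T₀ S X) (StrongMonad.T₀ T X))
       : Set (o ⊔ ℓ ⊔ e) where
  open Category 𝒞
  open SymmetricMonoidal M
  module S = StrongMonad S
  module T = StrongMonad T
  field
    natural : ∀ {X Y} {f : X ⇒ Y} → ι ∘ S.T₁ f ≈ T.T₁ f ∘ ι
    unit-law : ∀ {X} → ι {X} ∘ S.η ≈ T.η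
    mult-law : ∀ {X} → ι {X} ∘ S.μ ≈ T.μ ∘ (T.T₁ (ι {X}) ∘ ι {S.T₀ X})
    strength-law : ∀ {X Y} → ι {X ⊗₀ Y} ∘ S.τ ≈ T.τ ∘ (id {X} ⊗₁ ι {Y})
    mono : ∀ {X W} (g h : W ⇒ S.T₀ X) → ι ∘ g ≈ ι ∘ h → g ≈ h

-- Both categories have the objects
-- of C and I is the identity on objects, so this says: I is a functor
-- (respects ≈, identities, Kleisli composition), every I f is central, and
-- there is an inverse J on hom-setoids from central morphisms X → TY back to
-- morphisms X → ZY (hom-sets of Z(C_T) carry the equality of C_T).

record CorestrictsToIso {o ℓ e} {𝒞 : Category o ℓ e} {M : SymmetricMonoidal 𝒞}
       (Z T : StrongMonad M) (ι : ∀ {X} → Category._⇒_ 𝒞 (StrongMonad.T₀ Z X) (StrongMonad.T₀ T X))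
       : Set (o ⊔ ℓ ⊔ e) where
  open Category 𝒞
  module Z = StrongMonad Z
  module T = StrongMonad T
  field
    I-resp-≈ : ∀ {X Y} {f g : X ⇒ Z.T₀ Y} → f ≈ g → ι ∘ f ≈ ι ∘ g
    I-id : ∀ {X} → ι ∘ Z.η {X} ≈ T.η {X}
    I-⊙ : ∀ {X Y W} (g : Y ⇒ Z.T₀ W) (f : X ⇒ Z.T₀ Y) →
          ι ∘ (g Z.⊙ f) ≈ (ι ∘ g) T.⊙ (ι ∘ f)
    I-central : ∀ {X Y} (f : X ⇒ Z.T₀ Y) → T.IsCentral (ι ∘ f)
    J : ∀ {X Y} (g : X ⇒ T.T₀ Y) → T.IsCentral g → X ⇒ Z.T₀ Y
    J-resp-≈ : ∀ {X Y} (g g' : X ⇒ T.T₀ Y) (c : T.IsCentral g) (c' : T.IsCentral g') →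
               g ≈ g' → J g c ≈ J g' c'
    I∘J : ∀ {X Y} (g : X ⇒ T.T₀ Y) (c : T.IsCentral g) → ι ∘ J g c ≈ g
    J∘I : ∀ {X Y} (f : X ⇒ Z.T₀ Y) → J (ι ∘ f) (I-central f) ≈ f

{-# OPTIONS --safe #-}
module Submission where

open import Defs
open import Level using (Level)
open import Relation.Binary using (Setoid; IsEquivalence)
import Relation.Binary.Reasoning.Setoid as SetoidReasoning

-- Both (g ⊗ₗ Y') ⊙ (X ⊗ᵣ f') and (Y ⊗ᵣ f') ⊙ (g ⊗ₗ X') are a double strength precomposed
-- with g ⊗ f'. Hence a Kleisli morphism g : X → TY is central iff (X, g) is a central cone
-- at Y, and precomposing a central cone with any f yields a central morphism. So the central
-- morphisms X → TY are exactly the composites ι ∘ f with f : X → ZY, by terminality of the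
-- central cone ι at Y, and f is unique because ι is monic.

module HomReasoning {o ℓ e} (𝒞 : Category o ℓ e) where
  open Category 𝒞

  hom : Obj → Obj → Setoid ℓ e
  hom A B = record { Carrier = A ⇒ B ; _≈_ = _≈_ ; isEquivalence = equiv }

  module ≈ {A B : Obj} = IsEquivalence (equiv {A} {B})

  infixr 5 _⟩∘⟨_ refl⟩∘⟨_
  infixl 6 _⟩∘⟨refl

  _⟩∘⟨_ : ∀ {A B C} {f h : B ⇒ C} {g i : A ⇒ B} → f ≈ h → g ≈ i → f ∘ g ≈ h ∘ i
  _⟩∘⟨_ = ∘-resp-≈

  refl⟩∘⟨_ : ∀ {A B C} {f : B ⇒ C} {g i : A ⇒ B} → g ≈ i → f ∘ g ≈ f ∘ i
  refl⟩∘⟨ p = ∘-resp-≈ ≈.refl p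

  _⟩∘⟨refl : ∀ {A B C} {f h : B ⇒ C} {g : A ⇒ B} → f ≈ h → f ∘ g ≈ h ∘ g
  p ⟩∘⟨refl = ∘-resp-≈ p ≈.refl

  open module Reasoning {A B} = SetoidReasoning (hom A B) public

module MonoidalProperties {o ℓ e} {𝒞 : Category o ℓ e} (M : SymmetricMonoidal 𝒞) where
  open Category 𝒞
  open SymmetricMonoidal M
  open HomReasoning 𝒞

  ⊗≈⊗id∘id⊗ : ∀ {A B C D} {g : A ⇒ B} {f : C ⇒ D} → g ⊗₁ f ≈ (g ⊗₁ id) ∘ (id ⊗₁ f)
  ⊗≈⊗id∘id⊗ = ≈.trans (⊗-resp-≈ (≈.sym identityʳ) (≈.sym identityˡ)) ⊗-∘

  ⊗≈id⊗∘⊗id : ∀ {A B C D} {g : A ⇒ B} {f : C ⇒ D} → g ⊗₁ f ≈ (id ⊗₁ f) ∘ (g ⊗₁ id)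
  ⊗≈id⊗∘⊗id = ≈.trans (⊗-resp-≈ (≈.sym identityˡ) (≈.sym identityʳ)) ⊗-∘

  ∘⊗≈⊗id∘⊗ : ∀ {A B C D E} {g : B ⇒ C} {f : A ⇒ B} {h : D ⇒ E} →
             (g ∘ f) ⊗₁ h ≈ (g ⊗₁ id) ∘ (f ⊗₁ h)
  ∘⊗≈⊗id∘⊗ = ≈.trans (⊗-resp-≈ ≈.refl (≈.sym identityˡ)) ⊗-∘

module StrongMonadProperties {o ℓ e} {𝒞 : Category o ℓ e} {M : SymmetricMonoidal 𝒞}
                             (T : StrongMonad M) where
  open Category 𝒞
  open SymmetricMonoidal M
  open StrongMonad T
  open HomReasoning 𝒞
  open MonoidalProperties M

  τ'-natural : ∀ {X X' Y Y'} {g : X ⇒ X'} {h : Y ⇒ Y'} →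
               τ' ∘ (T₁ g ⊗₁ h) ≈ T₁ (g ⊗₁ h) ∘ τ'
  τ'-natural {g = g} {h} = begin
      (T₁ γ ∘ (τ ∘ γ)) ∘ (T₁ g ⊗₁ h)      ≈⟨ ≈.trans assoc (refl⟩∘⟨ assoc) ⟩
      T₁ γ ∘ (τ ∘ (γ ∘ (T₁ g ⊗₁ h)))      ≈⟨ refl⟩∘⟨ refl⟩∘⟨ γ-natural ⟩
      T₁ γ ∘ (τ ∘ ((h ⊗₁ T₁ g) ∘ γ))      ≈⟨ refl⟩∘⟨ ≈.sym assoc ⟩
      T₁ γ ∘ ((τ ∘ (h ⊗₁ T₁ g)) ∘ γ)      ≈⟨ refl⟩∘⟨ τ-natural ⟩∘⟨refl ⟩
      T₁ γ ∘ ((T₁ (h ⊗₁ g) ∘ τ) ∘ γ)      ≈⟨ ≈.trans (refl⟩∘⟨ assoc) (≈.sym assoc) ⟩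
      (T₁ γ ∘ T₁ (h ⊗₁ g)) ∘ (τ ∘ γ)      ≈⟨ ≈.sym T-∘ ⟩∘⟨refl ⟩
      T₁ (γ ∘ (h ⊗₁ g)) ∘ (τ ∘ γ)         ≈⟨ T-resp-≈ γ-natural ⟩∘⟨refl ⟩
      T₁ ((g ⊗₁ h) ∘ γ) ∘ (τ ∘ γ)         ≈⟨ T-∘ ⟩∘⟨refl ⟩
      (T₁ (g ⊗₁ h) ∘ T₁ γ) ∘ (τ ∘ γ)      ≈⟨ assoc ⟩
      T₁ (g ⊗₁ h) ∘ (T₁ γ ∘ (τ ∘ γ))      ∎

  ⊗ₗ-⊙-⊗ᵣ : ∀ {X Y X' Y'} (g : X ⇒ T₀ Y) (f' : X' ⇒ T₀ Y') →
            (g ⊗ₗ Y') ⊙ (X ⊗ᵣ f') ≈ dstr₁ Y Y' ∘ (g ⊗₁ f')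
  ⊗ₗ-⊙-⊗ᵣ g f' = begin
      μ ∘ (T₁ (τ' ∘ (g ⊗₁ id)) ∘ (τ ∘ (id ⊗₁ f')))      ≈⟨ refl⟩∘⟨ T-∘ ⟩∘⟨refl ⟩
      μ ∘ ((T₁ τ' ∘ T₁ (g ⊗₁ id)) ∘ (τ ∘ (id ⊗₁ f')))    ≈⟨ refl⟩∘⟨ ≈.trans assoc (refl⟩∘⟨ ≈.sym assoc) ⟩
      μ ∘ (T₁ τ' ∘ ((T₁ (g ⊗₁ id) ∘ τ) ∘ (id ⊗₁ f')))    ≈⟨ refl⟩∘⟨ refl⟩∘⟨ ≈.sym τ-natural ⟩∘⟨refl ⟩
      μ ∘ (T₁ τ' ∘ ((τ ∘ (g ⊗₁ T₁ id)) ∘ (id ⊗₁ f')))    ≈⟨ refl⟩∘⟨ refl⟩∘⟨ (refl⟩∘⟨ ⊗-resp-≈ ≈.refl T-id) ⟩∘⟨refl ⟩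
      μ ∘ (T₁ τ' ∘ ((τ ∘ (g ⊗₁ id)) ∘ (id ⊗₁ f')))       ≈⟨ refl⟩∘⟨ refl⟩∘⟨ ≈.trans assoc (refl⟩∘⟨ ≈.sym ⊗≈⊗id∘id⊗) ⟩
      μ ∘ (T₁ τ' ∘ (τ ∘ (g ⊗₁ f')))                      ≈⟨ ≈.trans (refl⟩∘⟨ ≈.sym assoc) (≈.sym assoc) ⟩
      (μ ∘ (T₁ τ' ∘ τ)) ∘ (g ⊗₁ f')                      ∎

  ⊗ᵣ-⊙-⊗ₗ : ∀ {X Y X' Y'} (g : X ⇒ T₀ Y) (f' : X' ⇒ T₀ Y') →
            (Y ⊗ᵣ f') ⊙ (g ⊗ₗ X') ≈ dstr₂ Y Y' ∘ (g ⊗₁ f')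
  ⊗ᵣ-⊙-⊗ₗ g f' = begin
      μ ∘ (T₁ (τ ∘ (id ⊗₁ f')) ∘ (τ' ∘ (g ⊗₁ id)))      ≈⟨ refl⟩∘⟨ T-∘ ⟩∘⟨refl ⟩
      μ ∘ ((T₁ τ ∘ T₁ (id ⊗₁ f')) ∘ (τ' ∘ (g ⊗₁ id)))    ≈⟨ refl⟩∘⟨ ≈.trans assoc (refl⟩∘⟨ ≈.sym assoc) ⟩
      μ ∘ (T₁ τ ∘ ((T₁ (id ⊗₁ f') ∘ τ') ∘ (g ⊗₁ id)))    ≈⟨ refl⟩∘⟨ refl⟩∘⟨ ≈.sym τ'-natural ⟩∘⟨refl ⟩
      μ ∘ (T₁ τ ∘ ((τ' ∘ (T₁ id ⊗₁ f')) ∘ (g ⊗₁ id)))    ≈⟨ refl⟩∘⟨ refl⟩∘⟨ (refl⟩∘⟨ ⊗-resp-≈ T-id ≈.refl) ⟩∘⟨refl ⟩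
      μ ∘ (T₁ τ ∘ ((τ' ∘ (id ⊗₁ f')) ∘ (g ⊗₁ id)))       ≈⟨ refl⟩∘⟨ refl⟩∘⟨ ≈.trans assoc (refl⟩∘⟨ ≈.sym ⊗≈id⊗∘⊗id) ⟩
      μ ∘ (T₁ τ ∘ (τ' ∘ (g ⊗₁ f')))                      ≈⟨ ≈.trans (refl⟩∘⟨ ≈.sym assoc) (≈.sym assoc) ⟩
      (μ ∘ (T₁ τ ∘ τ')) ∘ (g ⊗₁ f')                      ∎

  isCentral⇒isCentralCone : ∀ {X Y} {g : X ⇒ T₀ Y} → IsCentral g → IsCentralCone Y X g
  isCentral⇒isCentralCone {g = g} central Y' = begin
      dstr₁ _ Y' ∘ (g ⊗₁ id)   ≈⟨ ≈.sym (⊗ₗ-⊙-⊗ᵣ g id) ⟩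
      (g ⊗ₗ _) ⊙ (_ ⊗ᵣ id)     ≈⟨ central id ⟩
      (_ ⊗ᵣ id) ⊙ (g ⊗ₗ _)     ≈⟨ ⊗ᵣ-⊙-⊗ₗ g id ⟩
      dstr₂ _ Y' ∘ (g ⊗₁ id)   ∎

  isCentralCone⇒isCentral-∘ : ∀ {X Y W} {κ : W ⇒ T₀ Y} → IsCentralCone Y W κ →
                              (f : X ⇒ W) → IsCentral (κ ∘ f)
  isCentralCone⇒isCentral-∘ {κ = κ} cone f {Y' = Y'} f' = begin
      ((κ ∘ f) ⊗ₗ Y') ⊙ (_ ⊗ᵣ f')             ≈⟨ ⊗ₗ-⊙-⊗ᵣ (κ ∘ f) f' ⟩
      dstr₁ _ Y' ∘ ((κ ∘ f) ⊗₁ f')            ≈⟨ ≈.trans (refl⟩∘⟨ ∘⊗≈⊗id∘⊗) (≈.sym assoc) ⟩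
      (dstr₁ _ Y' ∘ (κ ⊗₁ id)) ∘ (f ⊗₁ f')    ≈⟨ cone Y' ⟩∘⟨refl ⟩
      (dstr₂ _ Y' ∘ (κ ⊗₁ id)) ∘ (f ⊗₁ f')    ≈⟨ ≈.trans assoc (refl⟩∘⟨ ≈.sym ∘⊗≈⊗id∘⊗) ⟩
      dstr₂ _ Y' ∘ ((κ ∘ f) ⊗₁ f')            ≈⟨ ≈.sym (⊗ᵣ-⊙-⊗ₗ (κ ∘ f) f') ⟩
      (_ ⊗ᵣ f') ⊙ ((κ ∘ f) ⊗ₗ _)             ∎

module StrongMonadMonoProperties {o ℓ e} {𝒞 : Category o ℓ e} {M : SymmetricMonoidal 𝒞}
    {S T : StrongMonad M}
    {ι : ∀ {X} → Category._⇒_ 𝒞 (StrongMonad.T₀ S X) (StrongMonad.T₀ T X)}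
    (mono : IsStrongMonadMono S T ι) where
  open Category 𝒞
  open IsStrongMonadMono mono
  open HomReasoning 𝒞

  ι-⊙ : ∀ {X Y W} (g : Y ⇒ S.T₀ W) (f : X ⇒ S.T₀ Y) → ι ∘ (g S.⊙ f) ≈ (ι ∘ g) T.⊙ (ι ∘ f)
  ι-⊙ g f = begin
      ι ∘ (S.μ ∘ (S.T₁ g ∘ f))                  ≈⟨ ≈.sym assoc ⟩
      (ι ∘ S.μ) ∘ (S.T₁ g ∘ f)                  ≈⟨ mult-law ⟩∘⟨refl ⟩
      (T.μ ∘ (T.T₁ ι ∘ ι)) ∘ (S.T₁ g ∘ f)       ≈⟨ ≈.trans assoc (refl⟩∘⟨ assoc) ⟩
      T.μ ∘ (T.T₁ ι ∘ (ι ∘ (S.T₁ g ∘ f)))       ≈⟨ refl⟩∘⟨ refl⟩∘⟨ ≈.sym assoc ⟩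
      T.μ ∘ (T.T₁ ι ∘ ((ι ∘ S.T₁ g) ∘ f))       ≈⟨ refl⟩∘⟨ refl⟩∘⟨ natural ⟩∘⟨refl ⟩
      T.μ ∘ (T.T₁ ι ∘ ((T.T₁ g ∘ ι) ∘ f))       ≈⟨ refl⟩∘⟨ ≈.trans (refl⟩∘⟨ assoc) (≈.sym assoc) ⟩
      T.μ ∘ ((T.T₁ ι ∘ T.T₁ g) ∘ (ι ∘ f))       ≈⟨ refl⟩∘⟨ ≈.sym T.T-∘ ⟩∘⟨refl ⟩
      T.μ ∘ (T.T₁ (ι ∘ g) ∘ (ι ∘ f))            ∎

theorem2p10 : ∀ {o ℓ e : Level} {𝒞 : Category o ℓ e} (M : SymmetricMonoidal 𝒞)
                (T Z : StrongMonad M)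
                (ι : ∀ {X} → Category._⇒_ 𝒞 (StrongMonad.T₀ Z X) (StrongMonad.T₀ T X)) →
                -- Z is a commutative strong monad, ι : Z ⇒ T a monomorphism of strong monads
                StrongMonad.IsCommutative Z →
                IsStrongMonadMono Z T ι →
                -- each (Z X, ι_X) is a terminal central cone of T at X (so T is centralisable and Z is its centre)
                (∀ X → StrongMonad.IsTerminalCentralCone T X (StrongMonad.T₀ Z X) (ι {X})) →
                CorestrictsToIso Z T ι
theorem2p10 {𝒞 = 𝒞} M T Z ι _ ι-mono terminal = record
  { I-resp-≈  = refl⟩∘⟨_
  ; I-id      = unit-law
  ; I-⊙       = ι-⊙
  ; I-central = I-central
  ; J         = J
  ; J-resp-≈  = λ g g' c c' g≈g' →
                  mono _ _ (≈.trans (I∘J g c) (≈.trans g≈g' (≈.sym (I∘J g' c'))))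
  ; I∘J       = I∘J
  ; J∘I       = λ f → mono _ _ (I∘J (ι ∘ f) (I-central f))
  }
  where
    open Category 𝒞
    open HomReasoning 𝒞 using (module ≈; refl⟩∘⟨_)
    open StrongMonadProperties T
    open StrongMonadMonoProperties ι-mono
    open IsStrongMonadMono ι-mono using (unit-law; mono)
    module Terminal X = StrongMonad.IsTerminalCentralCone (terminal X)

    I-central : ∀ {X Y} (f : X ⇒ StrongMonad.T₀ Z Y) → StrongMonad.IsCentral T (ι ∘ f)
    I-central {Y = Y} = isCentralCone⇒isCentral-∘ (Terminal.central Y)

    J : ∀ {X Y} (g : X ⇒ StrongMonad.T₀ T Y) → StrongMonad.IsCentral T g → X ⇒ StrongMonad.T₀ Z Y
    J {Y = Y} g c = Terminal.factor Y g (isCentral⇒isCentralCone c)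

    I∘J : ∀ {X Y} (g : X ⇒ StrongMonad.T₀ T Y) (c : StrongMonad.IsCentral T g) → ι ∘ J g c ≈ g
    I∘J {Y = Y} g c = Terminal.factor-commutes Y g (isCentral⇒isCentralCone c)
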